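{- Let $P$ be a finite set partially ordered by $\leq$. For every strict $P$-labelled tree $(N,E,\lambda)$ that is not nice, there exists a strict $P$-labelled tree $(N',E',\lambda')$ with $N'\subsetneq N$ and $(N,E,\lambda)\sim(N',E',\lambda')$.
   Context: A $P$-labelled tree is a triple $(N,E,\lambda)$ where $(N,E)$ is a finite (rooted) tree with edge relation $E$ (parent to child) and $\lambda:N\to P$ satisfies $\lambda(i)\leq\lambda(j)$ whenever $iEj$. It is strict if $iEj$ implies $\lambda(i)<\lambda(j)$ (i.e. $\lambda(i)\leq\lambda(j)$ and $\lambda(i)\neq\lambda(j)$). For a node $i$, $(N^i,E^i,\lambda^i)$ denotes the restriction of $(N,E,\lambda)$ to the set of nodes reachable from $i$ via $E^{\star}$. A $P$-isomorphism is a bijection $f:N\to N'$ with $iEj\iff f(i)E'f(j)$ and $\lambda(k)=\lambda'(f(k))$; write $\simeq$ for its existence. A strict $P$-labelled tree is nice if for all nodes $i,j,k$ with $kEi$, $kEj$, $i\neq j$, $(N^i,E^i,\lambda^i)\not\simeq(N^j,E^j,\lambda^j)$. A $P$-embedding of $(N,E,\lambda)$ into $(N',E',\lambda')$ is a function $f:N\to N'$ such that $iEj$ implies $f(i)\,E'^{\star}\,f(j)$ ($E'^{\star}$ the reflexive-transitive closure) and $\lambda(k)=\lambda'(f(k))$; $\sim$ holds iff there are $P$-embeddings in both directions. -}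

module Defs where

open import Data.Nat using (ℕ)
open import Data.Fin using (Fin)
open import Data.Bool using (Bool; T)
open import Data.Product using (Σ; ∃; _×_; _,_; proj₁)
open import Data.List using (List)
open import Data.List.Membership.Propositional using (_∈_)
open import Relation.Nullary using (¬_)
open import Relation.Binary.PropositionalEquality using (_≡_; _≢_)
open import Relation.Binary.Construct.Closure.ReflexiveTransitive using (Star)
open import Relation.Binary.Structures using (IsPartialOrder)

-- The finite poset P: carrier Fin p (any finite set, up to bijection),
-- with a partial order _≤_ (w.r.t. propositional equality).
record FinPoset : Set₁ where
  field
    size   : ℕ
    _≤_    : Fin size → Fin size → Set
    isPO   : IsPartialOrder _≡_ _≤_
  Elem : Set
  Elem = Fin size

record LGraph (U : Set) (L : Set) : Set₁ where
  field
    Nd  : U → Set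
    E   : U → U → Set     -- parent → child
    lab : U → L

record PTree (P : FinPoset) (U : Set) : Set₁ where
  open FinPoset P
  field
    node  : U → Bool
    E     : U → U → Set
    lab   : U → Elem
    finite   : Σ (List U) λ xs → ∀ u → T (node u) → u ∈ xs
    E-nodes  : ∀ {u v} → E u v → T (node u) × T (node v)
    root       : U
    root-node  : T (node root)
    root-noPar : ∀ u → ¬ E u root
    parent     : ∀ v → T (node v) → v ≢ root →
                 Σ U λ u → E u v × (∀ w → E w v → w ≡ u)
    reach      : ∀ v → T (node v) → Star E root v
    monotone   : ∀ {u v} → E u v → lab u ≤ lab v

  graph : LGraph U Elem
  graph = record { Nd = λ u → T (node u) ; E = E ; lab = lab }

  sub : U → LGraph U Elem
  sub i = record
    { Nd  = λ k → T (node k) × Star E i k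
    ; E   = λ k l → (T (node k) × Star E i k) × (T (node l) × Star E i l) × E k l
    ; lab = lab }

Strict : {P : FinPoset} {U : Set} → PTree P U → Set
Strict {P} t = ∀ {u v} → E u v → lab u ≤ lab v × lab u ≢ lab v
  where open FinPoset P ; open PTree t

module _ {U L : Set} where
  record Iso (G : LGraph U L) (H : LGraph U L) : Set where
    open LGraph G renaming (Nd to N₁; E to E₁; lab to l₁)
    open LGraph H renaming (Nd to N₂; E to E₂; lab to l₂)
    field
      f     : (x : U) → N₁ x → U
      f-nd  : ∀ x p → N₂ (f x p)
      g     : (y : U) → N₂ y → U
      g-nd  : ∀ y q → N₁ (g y q)
      gf    : ∀ x p q → g (f x p) q ≡ x
      fg    : ∀ y q p → f (g y q) p ≡ y
      E-pres : ∀ x y p q → E₁ x y → E₂ (f x p) (f y q)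
      E-refl : ∀ x y p q → E₂ (f x p) (f y q) → E₁ x y
      lab-pres : ∀ x p → l₁ x ≡ l₂ (f x p)

  record Emb (G : LGraph U L) (H : LGraph U L) : Set where
    open LGraph G renaming (Nd to N₁; E to E₁; lab to l₁)
    open LGraph H renaming (Nd to N₂; E to E₂; lab to l₂)
    field
      f     : (x : U) → N₁ x → U
      f-nd  : ∀ x p → N₂ (f x p)
      E-pres : ∀ x y p q → E₁ x y → Star E₂ (f x p) (f y q)
      lab-pres : ∀ x p → l₁ x ≡ l₂ (f x p)

  _∼_ : LGraph U L → LGraph U L → Set
  G ∼ H = Emb G H × Emb H G

Nice : {P : FinPoset} {U : Set} → PTree P U → Set
Nice {P} t = Strict t ×
  (∀ i j k → E k i → E k j → i ≢ j → ¬ Iso (sub i) (sub j))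
  where open PTree t

-- If siblings i ≠ j have isomorphic subtrees, delete the subtree at i.  The
-- inclusion embeds the pruned tree into the original one; conversely, nodes
-- outside the subtree at i stay fixed and the subtree at i is sent into the
-- subtree at j.  Since non-niceness is only a negative statement, the witness
-- is obtained by deciding a weaker, decidable property of sibling pairs: a
-- depth-bounded simulation of the subtree at i into the subtree at j.  It is
-- implied by an isomorphism and already suffices to build the embedding.
module Submission where

open import Data.Bool using (Bool; T)
open import Data.Bool.Properties using (T-irrelevant)
open import Data.Empty using (⊥; ⊥-elim)
open import Data.Fin using () renaming (_≟_ to _≟ᶠ_)
open import Data.List using (List; []; _∷_; length; filter; lookup)
open import Data.List.Membership.Propositional using (_∈_; find; lose)
open import Data.List.Membership.Propositional.Properties using (∈-filter⁺; ∈-filter⁻)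
open import Data.List.Relation.Unary.All as All using (All; all?)
open import Data.List.Relation.Unary.Any as Any using (Any; here; there; any?)
open import Data.List.Relation.Unary.Any.Properties using (lookup-index)
open import Data.Nat using (ℕ; zero; suc; _<_; _≤_; s≤s; z≤n)
open import Data.Nat.Properties using (<-≤-trans; m≤n⇒m≤1+n)
open import Data.List.Properties using (length-filter)
open import Data.Product using (Σ; ∃-syntax; _×_; _,_; proj₁; proj₂)
open import Data.Sum using (_⊎_; inj₁; inj₂)
open import Defs
open import Level using (_⊔_)
open import Relation.Binary.Core using (Rel)
open import Relation.Binary.Construct.Closure.ReflexiveTransitive using (Star; ε; _◅_; _◅◅_)
open import Relation.Binary.PropositionalEquality using (_≡_; _≢_; refl; sym; trans; cong; subst)
open import Relation.Binary.Structures using (IsPartialOrder)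
open import Relation.Nullary using (¬_; Dec; yes; no; contradiction)
open import Relation.Nullary.Decidable using (T?; _×-dec_; map′; ¬?; ⌊_⌋; toWitness; fromWitness)
open import Relation.Unary using (Pred; Decidable; _⊆_)

module _ {a p q} {A : Set a} {P : Pred A p} {Q : Pred A q}
         (P? : Decidable P) (Q? : Decidable Q) (P⊆Q : P ⊆ Q) where

  length-filter-mono : ∀ xs → length (filter P? xs) ≤ length (filter Q? xs)
  length-filter-mono []       = z≤n
  length-filter-mono (x ∷ xs) with P? x | Q? x
  ... | yes _  | yes _  = s≤s (length-filter-mono xs)
  ... | yes px | no ¬qx = contradiction (P⊆Q px) ¬qx
  ... | no _   | yes _  = m≤n⇒m≤1+n (length-filter-mono xs)
  ... | no _   | no _   = length-filter-mono xs

  length-filter-strict-mono : ∀ {x} xs → x ∈ xs → Q x → ¬ P x →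
                              length (filter P? xs) < length (filter Q? xs)
  length-filter-strict-mono (x ∷ xs) (here refl) qx ¬px with P? x | Q? x
  ... | yes px | _      = contradiction px ¬px
  ... | no _   | yes _  = s≤s (length-filter-mono xs)
  ... | no _   | no ¬qx = contradiction qx ¬qx
  length-filter-strict-mono (y ∷ xs) (there x∈xs) qx ¬px with P? y | Q? y
  ... | yes _  | yes _  = s≤s (length-filter-strict-mono xs x∈xs qx ¬px)
  ... | yes py | no ¬qy = contradiction (P⊆Q py) ¬qy
  ... | no _   | yes _  = m≤n⇒m≤1+n (length-filter-strict-mono xs x∈xs qx ¬px)
  ... | no _   | no _   = length-filter-strict-mono xs x∈xs qx ¬px

-- Star with its last step exposed; in a tree the last edge into a node is
-- determined by the node.
infixl 5 _▻_
data Path {a r} {A : Set a} (R : Rel A r) (x : A) : A → Set (a ⊔ r) where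
  ε   : Path R x x
  _▻_ : ∀ {y z} → Path R x y → R y z → Path R x z

module _ {a r} {A : Set a} {R : Rel A r} where

  _◅ᵖ_ : ∀ {x y z} → R x y → Path R y z → Path R x z
  e ◅ᵖ ε       = ε ▻ e
  e ◅ᵖ (p ▻ f) = (e ◅ᵖ p) ▻ f

  fromStar : ∀ {x y} → Star R x y → Path R x y
  fromStar ε       = ε
  fromStar (e ◅ s) = e ◅ᵖ fromStar s

  toStar : ∀ {x y} → Path R x y → Star R x y
  toStar ε       = ε
  toStar (p ▻ e) = toStar p ◅◅ (e ◅ ε)

module StrictTree {P : FinPoset} {U : Set} (t : PTree P U) (strict : Strict t) where
  open FinPoset P using () renaming (_≤_ to _⊑_)
  open PTree t
  private module ⊑ = IsPartialOrder (FinPoset.isPO P)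

  nodes : List U
  nodes = proj₁ finite

  ∈-nodes : ∀ {u} → T (node u) → u ∈ nodes
  ∈-nodes = proj₂ finite _

  -- U need not have decidable equality; nodes are compared through their
  -- positions in the enumeration given by `finite`.
  ≟-node : ∀ u v → T (node v) → Dec (u ≡ v)
  ≟-node u v nv with T? (node u)
  ... | no ¬nu = no λ { refl → ¬nu nv }
  ... | yes nu with Any.index (∈-nodes nu) ≟ᶠ Any.index (∈-nodes nv)
  ... | yes same = yes (trans (lookup-index (∈-nodes nu))
                        (trans (cong (lookup nodes) same) (sym (lookup-index (∈-nodes nv)))))
  ... | no differ = no λ { refl → differ (cong (λ n → Any.index (∈-nodes n)) (T-irrelevant nu nv)) }

  node×? : ∀ {r} {R : Pred U r} → (∀ u → T (node u) → Dec (R u)) →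
           Decidable (λ u → T (node u) × R u)
  node×? R? u with T? (node u)
  ... | no ¬nu = no λ r → ¬nu (proj₁ r)
  ... | yes nu = map′ (nu ,_) proj₂ (R? u nu)

  ⋆-node : ∀ {a b} → Star E a b → T (node a) → T (node b)
  ⋆-node ε       na = na
  ⋆-node (e ◅ s) _  = ⋆-node s (proj₂ (E-nodes e))

  lab-mono⋆ : ∀ {a b} → Star E a b → lab a ⊑ lab b
  lab-mono⋆ ε       = ⊑.refl
  lab-mono⋆ (e ◅ s) = ⊑.trans (proj₁ (strict e)) (lab-mono⋆ s)

  E-acyclic : ∀ {a b} → E a b → ¬ Star E b a
  E-acyclic e s = proj₂ (strict e) (⊑.antisym (proj₁ (strict e)) (lab-mono⋆ s))

  ⋆root⇒≡root : ∀ {a} → Star E a root → a ≡ root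
  ⋆root⇒≡root ε = refl
  ⋆root⇒≡root (e ◅ s) with refl ← ⋆root⇒≡root s = contradiction e (root-noPar _)

  parent-unique : ∀ {w₁ w₂ z} → E w₁ z → E w₂ z → w₁ ≡ w₂
  parent-unique {w₁} {w₂} {z} e₁ e₂ with ≟-node z root root-node
  ... | yes refl = contradiction e₁ (root-noPar _)
  ... | no z≢root with _ , _ , unique ← parent z (proj₂ (E-nodes e₁)) z≢root =
    trans (unique w₁ e₁) (sym (unique w₂ e₂))

  ⋆-init : ∀ {a u w} → Star E a u → a ≢ u → E w u → Star E a w
  ⋆-init s a≢u e with fromStar s
  ... | ε     = contradiction refl a≢u
  ... | p ▻ f with refl ← parent-unique f e = toStar p

  ⋆-comparable : ∀ {a b z} → Path E a z → Path E b z → Star E a b ⊎ Star E b a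
  ⋆-comparable ε        q        = inj₂ (toStar q)
  ⋆-comparable (p ▻ e)  ε        = inj₁ (toStar (p ▻ e))
  ⋆-comparable (p ▻ e₁) (q ▻ e₂) with refl ← parent-unique e₁ e₂ = ⋆-comparable p q

  ⋆? : ∀ a u → T (node u) → Dec (Star E a u)
  ⋆? a u nu = from-root nu (fromStar (reach u nu))
    where
    from-root : ∀ {v} → T (node v) → Path E root v → Dec (Star E a v)
    from-root {v} nv p with ≟-node a v nv
    ... | yes refl = yes ε
    from-root nv ε       | no a≢v = no λ s → a≢v (⋆root⇒≡root s)
    from-root nv (p ▻ e) | no a≢v =
      map′ (λ s → s ◅◅ (e ◅ ε)) (λ s → ⋆-init s a≢v e) (from-root (proj₁ (E-nodes e)) p)

  E? : ∀ x c → T (node c) → Dec (E x c)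
  E? x c nc with ≟-node c root root-node
  ... | yes refl = no (root-noPar x)
  ... | no c≢root with p , e , unique ← parent c nc c≢root
                  with ≟-node x p (proj₁ (E-nodes e))
  ...   | yes refl = yes e
  ...   | no x≢p   = no λ e′ → x≢p (unique x e′)

  Below : U → Pred U _
  Below a = LGraph.Nd (sub a)

  Below? : ∀ a → Decidable (Below a)
  Below? a = node×? (⋆? a)

  children : U → List U
  children x = filter (node×? (E? x)) nodes

  ∈-children⁺ : ∀ {x c} → E x c → c ∈ children x
  ∈-children⁺ e = ∈-filter⁺ (node×? (E? _)) (∈-nodes (proj₂ (E-nodes e))) (proj₂ (E-nodes e) , e)

  ∈-children⁻ : ∀ {x c} → c ∈ children x → E x c
  ∈-children⁻ c∈ = proj₂ (proj₂ (∈-filter⁻ (node×? (E? _)) {xs = nodes} c∈))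

  size : U → ℕ
  size x = length (filter (Below? x) nodes)

  size-child : ∀ {x c} → E x c → size c < size x
  size-child e = length-filter-strict-mono (Below? _) (Below? _)
    (λ (nc , s) → nc , e ◅ s) nodes (∈-nodes nx) (nx , ε) (λ (_ , s) → E-acyclic e s)
    where nx = proj₁ (E-nodes e)

  bound : ℕ
  bound = suc (length nodes)

  size<bound : ∀ x → size x < bound
  size<bound x = s≤s (length-filter (Below? x) nodes)

  -- Sim n x y: the subtree at x, cut at depth n, maps label-preservingly into
  -- the subtree at y sending children to children.  Unlike P-isomorphism of
  -- subtrees, this is decidable.
  Sim : ℕ → U → U → Set
  Sim zero    _ _ = ⊥
  Sim (suc n) x y = lab x ≡ lab y × All (λ c → Any (Sim n c) (children y)) (children x)

  Sim? : ∀ n x y → Dec (Sim n x y)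
  Sim? zero    _ _ = no λ ()
  Sim? (suc n) x y = (lab x ≟ᶠ lab y)
    ×-dec all? (λ c → any? (Sim? n c) (children y)) (children x)

  Sim-suc : ∀ n {x y} → Sim n x y → Sim (suc n) x y
  Sim-suc (suc n) (x≡y , sims) = x≡y , All.map (Any.map (Sim-suc n)) sims

  Sim-child : ∀ {n x y u} → Sim (suc n) x y → E x u → Any (Sim n u) (children y)
  Sim-child (_ , sims) e = All.lookup sims (∈-children⁺ e)

  Iso⇒Sim : ∀ {a b} (φ : Iso (sub a) (sub b)) n x (p : Below a x) →
            size x < n → Sim n x (Iso.f φ x p)
  Iso⇒Sim φ (suc n) x p (s≤s size≤n) = lab-pres x p , All.tabulate sim-child
    where
    open Iso φ
    sim-child : ∀ {c} → c ∈ children x → Any (Sim n c) (children (f x p))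
    sim-child {c} c∈ = lose (∈-children⁺ (proj₂ (proj₂ (E-pres x c p q (p , q , e)))))
                            (Iso⇒Sim φ n c q (<-≤-trans (size-child e) size≤n))
      where
      e = ∈-children⁻ c∈
      q = proj₂ (E-nodes e) , proj₂ p ◅◅ (e ◅ ε)

  record SimilarSiblings : Set where
    field
      {k i j y} : U
      k→i       : E k i
      k→j       : E k j
      i≢j       : i ≢ j
      j⋆y       : Star E j y
      i≲y       : Sim bound i y

  similarSiblings? : Dec SimilarSiblings
  similarSiblings? = map′ fromAny toAny
    (any? (λ k → any? (λ i → any? (similar? i) (children k)) (children k)) nodes)
    where
    Similar : U → U → Set
    Similar i j = T (node j) × i ≢ j × Any (λ y → Below j y × Sim bound i y) nodes

    similar? : ∀ i → Decidable (Similar i)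
    similar? i = node×? λ j nj →
      ¬? (≟-node i j nj) ×-dec any? (λ y → Below? j y ×-dec Sim? bound i y) nodes

    fromAny : Any (λ k → Any (λ i → Any (Similar i) (children k)) (children k)) nodes →
              SimilarSiblings
    fromAny sim =
      let k , sim₁               = Any.satisfied sim
          i , i∈ , sim₂          = find sim₁
          j , j∈ , _ , i≢j , sim₃ = find sim₂
          y , (_ , j⋆y) , i≲y    = Any.satisfied sim₃
      in record { k→i = ∈-children⁻ i∈ ; k→j = ∈-children⁻ j∈ ; i≢j = i≢j
                ; j⋆y = j⋆y ; i≲y = i≲y }

    toAny : SimilarSiblings →
            Any (λ k → Any (λ i → Any (Similar i) (children k)) (children k)) nodes
    toAny w = lose (∈-nodes nk) (lose (∈-children⁺ k→i) (lose (∈-children⁺ k→j)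
                (nj , i≢j , lose (∈-nodes ny) ((ny , j⋆y) , i≲y))))
      where
      open SimilarSiblings w
      nk = proj₁ (E-nodes k→i)
      nj = proj₂ (E-nodes k→j)
      ny = ⋆-node j⋆y nj

  Iso⇒SimilarSiblings : ∀ {k i j} → E k i → E k j → i ≢ j → Iso (sub i) (sub j) →
                        SimilarSiblings
  Iso⇒SimilarSiblings k→i k→j i≢j φ = record
    { k→i = k→i ; k→j = k→j ; i≢j = i≢j
    ; j⋆y = proj₂ (Iso.f-nd φ _ i∈sub) ; i≲y = Iso⇒Sim φ bound _ i∈sub (size<bound _) }
    where i∈sub = proj₂ (E-nodes k→i) , ε

  module Pruning (w : SimilarSiblings) where
    open SimilarSiblings w

    Kept : Pred U _
    Kept u = T (node u) × ¬ Star E i u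

    Kept? : Decidable Kept
    Kept? = node×? λ u nu → ¬? (⋆? i u nu)

    kept : U → Bool
    kept u = ⌊ Kept? u ⌋

    E′ : U → U → Set
    E′ u v = T (kept u) × T (kept v) × E u v

    Kept-below-j : ∀ {z} → Star E j z → Kept z
    Kept-below-j {z} j⋆z = ⋆-node j⋆z (proj₂ (E-nodes k→j)) , ¬i⋆z
      where
      ¬i⋆z : ¬ Star E i z
      ¬i⋆z i⋆z with ⋆-comparable (fromStar i⋆z) (fromStar j⋆z)
      ... | inj₁ i⋆j = E-acyclic k→i (⋆-init i⋆j i≢j k→j)
      ... | inj₂ j⋆i = E-acyclic k→j (⋆-init j⋆i (λ j≡i → i≢j (sym j≡i)) k→i)

    Kept-k : Kept k
    Kept-k = proj₁ (E-nodes k→i) , E-acyclic k→i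

    Kept-root : Kept root
    Kept-root = root-node , λ i⋆root → root-noPar k (subst (E k) (⋆root⇒≡root i⋆root) k→i)

    Kept-⋆ : ∀ {a b} → Kept a → Kept b → Star E a b → Star E′ a b
    Kept-⋆ ka kb ε       = ε
    Kept-⋆ ka kb (e ◅ s) = (fromWitness ka , fromWitness kc , e) ◅ Kept-⋆ kc kb s
      where kc = proj₂ (E-nodes e) , λ i⋆c → proj₂ kb (i⋆c ◅◅ s)

    pruned : PTree P U
    pruned = record
      { node       = kept
      ; E          = E′
      ; lab        = lab
      ; finite     = nodes , λ u ku → ∈-nodes (proj₁ (toWitness ku))
      ; E-nodes    = λ (ku , kv , _) → ku , kv
      ; root       = root
      ; root-node  = fromWitness Kept-root
      ; root-noPar = λ u e′ → root-noPar u (proj₂ (proj₂ e′))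
      ; parent     = parent′
      ; reach      = λ v kv → Kept-⋆ Kept-root (toWitness kv) (reach v (proj₁ (toWitness kv)))
      ; monotone   = λ e′ → monotone (proj₂ (proj₂ e′))
      }
      where
      parent′ : ∀ v → T (kept v) → v ≢ root → Σ U λ u → E′ u v × (∀ w → E′ w v → w ≡ u)
      parent′ v kv v≢root with p , e , unique ← parent v (proj₁ (toWitness kv)) v≢root =
        p , (fromWitness kp , kv , e) , λ w e′ → unique w (proj₂ (proj₂ e′))
        where kp = proj₁ (E-nodes e) , λ i⋆p → proj₂ (toWitness kv) (i⋆p ◅◅ (e ◅ ε))

    pruned-strict : Strict pruned
    pruned-strict e′ = strict (proj₂ (proj₂ e′))

    pruned-⊆ : ∀ u → T (kept u) → T (node u)
    pruned-⊆ u ku = proj₁ (toWitness ku)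

    i-pruned : ¬ T (kept i)
    i-pruned ki = proj₂ (toWitness ki) ε

    inclusion : Emb (PTree.graph pruned) graph
    inclusion = record
      { f = λ x _ → x ; f-nd = pruned-⊆ ; E-pres = λ _ _ _ _ e′ → proj₂ (proj₂ e′) ◅ ε
      ; lab-pres = λ _ _ → refl }

    Image : U → Set
    Image u = ∃[ y ] Star E j y × Sim bound u y

    -- The child is found by the decision procedure rather than read off the
    -- given proof, so it depends only on u and v; this makes the image of a
    -- node independent of the path used to reach it.
    choose : ∀ u v → Any (Sim bound u) (children v) → ∃[ c ] E v c × Sim bound u c
    choose u v ex with any? (Sim? bound u) (children v)
    ... | yes sims = let c , c∈ , sim = find sims in c , ∈-children⁻ c∈ , sim
    ... | no ¬sims = contradiction ex ¬sims

    choose-cong : ∀ u {v₁ v₂} → v₁ ≡ v₂ → ∀ ex₁ ex₂ →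
                  proj₁ (choose u v₁ ex₁) ≡ proj₁ (choose u v₂ ex₂)
    choose-cong u {v} refl ex₁ ex₂ with any? (Sim? bound u) (children v)
    ... | yes _    = refl
    ... | no ¬sims = contradiction ex₁ ¬sims

    image-step : ∀ {w u} → Image w → E w u → Image u
    image-step {u = u} (y , j⋆y , w≲y) e =
      let c , y→c , u≲c = choose u y (Any.map (Sim-suc _) (Sim-child w≲y e))
      in c , j⋆y ◅◅ (y→c ◅ ε) , u≲c

    image : ∀ {u} → Path E i u → Image u
    image ε       = y , j⋆y , i≲y
    image (p ▻ e) = image-step (image p) e

    image-unique : ∀ {u} (p₁ p₂ : Path E i u) → proj₁ (image p₁) ≡ proj₁ (image p₂)
    image-unique ε         ε         = refl
    image-unique ε         (p₂ ▻ e₂) = contradiction (toStar p₂) (E-acyclic e₂)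
    image-unique (p₁ ▻ e₁) ε         = contradiction (toStar p₁) (E-acyclic e₁)
    image-unique (p₁ ▻ e₁) (p₂ ▻ e₂) with refl ← parent-unique e₁ e₂ =
      choose-cong _ (image-unique p₁ p₂) _ _

    fold : (x : U) → T (node x) → U
    fold x nx with ⋆? i x nx
    ... | yes i⋆x = proj₁ (image (fromStar i⋆x))
    ... | no _    = x

    fold-kept : ∀ x nx → T (kept (fold x nx))
    fold-kept x nx with ⋆? i x nx
    ... | yes i⋆x = fromWitness (Kept-below-j (proj₁ (proj₂ (image (fromStar i⋆x)))))
    ... | no ¬i⋆x = fromWitness (nx , ¬i⋆x)

    fold-lab : ∀ x nx → lab x ≡ lab (fold x nx)
    fold-lab x nx with ⋆? i x nx
    ... | yes i⋆x = proj₁ (proj₂ (proj₂ (image (fromStar i⋆x))))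
    ... | no _    = refl

    fold-E : ∀ x y nx ny → E x y → Star E′ (fold x nx) (fold y ny)
    fold-E x y nx ny e with ⋆? i x nx | ⋆? i y ny
    ... | yes i⋆x | no ¬i⋆y = contradiction (i⋆x ◅◅ (e ◅ ε)) ¬i⋆y
    ... | no ¬i⋆x | no ¬i⋆y = (fromWitness (nx , ¬i⋆x) , fromWitness (ny , ¬i⋆y) , e) ◅ ε
    ... | yes i⋆x | yes i⋆y =
      subst (Star E′ _) (image-unique (fromStar i⋆x ▻ e) (fromStar i⋆y))
        ((fromWitness (Kept-below-j j⋆z) , fromWitness (Kept-below-j j⋆c) , z→c) ◅ ε)
      where
      j⋆z = proj₁ (proj₂ (image (fromStar i⋆x)))
      j⋆c = proj₁ (proj₂ (image (fromStar i⋆x ▻ e)))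
      z→c = proj₁ (proj₂ (choose y _ _))
    ... | no ¬i⋆x | yes i⋆y with ≟-node i y ny
    ...   | no i≢y = contradiction (⋆-init i⋆y i≢y e) ¬i⋆x
    ...   | yes refl with refl ← parent-unique e k→i =
      subst (Star E′ k) (image-unique ε (fromStar i⋆y)) (Kept-⋆ Kept-k (Kept-below-j j⋆y) (k→j ◅ j⋆y))

    folding : Emb graph (PTree.graph pruned)
    folding = record { f = fold ; f-nd = fold-kept ; E-pres = fold-E ; lab-pres = fold-lab }

lemma5 : (P : FinPoset) (U : Set) (t : PTree P U) →
         Strict t → ¬ Nice t →
         Σ (PTree P U) λ t' → Strict t' ×
           (∀ u → T (PTree.node t' u) → T (PTree.node t u)) ×
           Σ U (λ u → T (PTree.node t u) × ¬ T (PTree.node t' u)) ×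
           (PTree.graph t ∼ PTree.graph t')
lemma5 P U t strict ¬nice with StrictTree.similarSiblings? t strict
... | yes w = pruned , pruned-strict , pruned-⊆ , (i , proj₂ (E-nodes k→i) , i-pruned) ,
              folding , inclusion
  where open StrictTree t strict ; open Pruning w ; open SimilarSiblings w ; open PTree t
... | no ¬w = ⊥-elim (¬nice (strict , λ i j k k→i k→j i≢j φ →
                ¬w (StrictTree.Iso⇒SimilarSiblings t strict k→i k→j i≢j φ)))
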